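{- Let $\langle D;<\rangle$ be a (strict) linear order. Then $\langle D;<\rangle$ satisfies the scheme $\mathtt{D\text{ - }Sup}$ if and only if it satisfies the scheme $\mathtt{D\text{ - }Cut}$.
   Context: Formulas are first-order formulas in the language $\{<\}$; a scheme holds in a structure if every instance (with further free variables read universally, as parameters) is true in it. $\mathtt{D\text{ - }Sup}$ is the scheme $$\exists x\,\varphi(x)\wedge\exists y\,\forall x\,[\varphi(x)\rightarrow x\leqslant y]\longrightarrow\exists z\,\forall y\,\big(\forall x\,[\varphi(x)\rightarrow x\leqslant y]\leftrightarrow z\leqslant y\big)$$ for arbitrary formulas $\varphi$, and $\mathtt{D\text{ - }Cut}$ is the scheme $$\exists x\,\exists y\,[\varphi(x)\wedge\psi(y)]\wedge\forall x\,\forall y\,[\varphi(x)\wedge\psi(y)\rightarrow x<y]\longrightarrow\exists z\,\forall x\,\forall y\,[\varphi(x)\wedge\psi(y)\rightarrow x\leqslant z\leqslant y]$$ for arbitrary formulas $\varphi,\psi$. -}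

module Defs where

open import Data.Nat using (ℕ; suc)
open import Data.Fin using (Fin; zero; suc)
open import Data.Product using (Σ; _×_; _,_)
open import Data.Sum using (_⊎_)
open import Data.Empty using (⊥)
open import Data.Unit using (⊤)
open import Relation.Binary.PropositionalEquality using (_≡_)
open import Relation.Binary.Structures using (IsStrictTotalOrder)

record LinearOrder : Set₁ where
  field
    D        : Set
    _<_      : D → D → Set
    isSTO    : IsStrictTotalOrder _≡_ _<_

  _≤_ : D → D → Set
  x ≤ y = (x < y) ⊎ (x ≡ y)

-- First-order formulas in the language {<} (with equality),
-- with free variables among Fin n (de Bruijn; var zero is the innermost).
data Formula : ℕ → Set where
  _<'_ _≐_     : ∀ {n} → Fin n → Fin n → Formula n
  ⊥' ⊤'        : ∀ {n} → Formula n
  ¬'_          : ∀ {n} → Formula n → Formula n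
  _∧'_ _∨'_ _⇒'_ : ∀ {n} → Formula n → Formula n → Formula n
  ∀'_ ∃'_      : ∀ {n} → Formula (suc n) → Formula n

_∷ₑ_ : ∀ {A : Set} {n} → A → (Fin n → A) → Fin (suc n) → A
(a ∷ₑ ρ) zero    = a
(a ∷ₑ ρ) (suc i) = ρ i

module _ (O : LinearOrder) where
  open LinearOrder O

  Sat : ∀ {n} → Formula n → (Fin n → D) → Set
  Sat (i <' j) ρ = ρ i < ρ j
  Sat (i ≐ j)  ρ = ρ i ≡ ρ j
  Sat ⊥'       ρ = ⊥
  Sat ⊤'       ρ = ⊤
  Sat (¬' φ)   ρ = Sat φ ρ → ⊥
  Sat (φ ∧' ψ) ρ = Sat φ ρ × Sat ψ ρ
  Sat (φ ∨' ψ) ρ = Sat φ ρ ⊎ Sat ψ ρ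
  Sat (φ ⇒' ψ) ρ = Sat φ ρ → Sat ψ ρ
  Sat (∀' φ)   ρ = ∀ d → Sat φ (d ∷ₑ ρ)
  Sat (∃' φ)   ρ = Σ D λ d → Sat φ (d ∷ₑ ρ)

  UB : ∀ {n} → Formula (suc n) → (Fin n → D) → D → Set
  UB φ ρ y = ∀ x → Sat φ (x ∷ₑ ρ) → x ≤ y

  D-Sup : Set
  D-Sup = ∀ n (φ : Formula (suc n)) (ρ : Fin n → D) →
          (Σ D λ x → Sat φ (x ∷ₑ ρ)) × (Σ D λ y → UB φ ρ y) →
          Σ D λ z → ∀ y → ((UB φ ρ y → z ≤ y) × (z ≤ y → UB φ ρ y))

  D-Cut : Set
  D-Cut = ∀ n (φ ψ : Formula (suc n)) (ρ : Fin n → D) →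
          (Σ D λ x → Σ D λ y → Sat φ (x ∷ₑ ρ) × Sat ψ (y ∷ₑ ρ)) ×
          (∀ x y → Sat φ (x ∷ₑ ρ) × Sat ψ (y ∷ₑ ρ) → x < y) →
          Σ D λ z → ∀ x y → Sat φ (x ∷ₑ ρ) × Sat ψ (y ∷ₑ ρ) → (x ≤ z) × (z ≤ y)

-- D-Sup ⇒ D-Cut: the supremum of φ is a cut point between φ and ψ.
-- D-Cut ⇒ D-Sup: by excluded middle φ either has a maximum, which is its
-- supremum, or it lies strictly below upperBounds φ; then a cut point
-- between φ and upperBounds φ is the supremum.
module Submission where

open import Defs
open import Data.Nat using (suc)
open import Data.Fin using (Fin; zero; suc)
open import Data.Product using (Σ; _×_; _,_; proj₁; proj₂; map₂)
open import Data.Product.Function.NonDependent.Propositional using (_×-⇔_)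
open import Data.Sum using (inj₁; inj₂)
open import Data.Sum.Function.Propositional using (_⊎-⇔_)
open import Data.Empty using (⊥-elim)
open import Function.Bundles using (_⇔_; mk⇔; Equivalence)
open import Function.Construct.Identity using (⇔-id)
open import Function.Related.TypeIsomorphisms using (→-cong-⇔; ¬-cong-⇔)
open import Relation.Nullary using (¬_; yes; no)
open import Relation.Binary.Definitions using (Transitive)
open import Relation.Binary.PropositionalEquality using (_≡_; refl; resp₂)
open import Relation.Binary.PropositionalEquality.Properties using (isEquivalence)
open import Relation.Binary.Structures using (IsStrictTotalOrder)
import Relation.Binary.Construct.StrictToNonStrict as StrictToNonStrict
open import Axiom.ExcludedMiddle using (ExcludedMiddle)
open import Level using (0ℓ)

open Equivalence using (to; from)

module Bounds {A : Set} (_<_ : A → A → Set) (<-trans : Transitive _<_) where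
  open StrictToNonStrict _≡_ _<_ using (_≤_)

  ≤-trans : Transitive _≤_
  ≤-trans = StrictToNonStrict.trans _≡_ _<_ isEquivalence (resp₂ _<_) <-trans

  UpperBound : (A → Set) → A → Set
  UpperBound P y = ∀ x → P x → x ≤ y

  IsSupremum : (A → Set) → A → Set
  IsSupremum P z = ∀ y → (UpperBound P y → z ≤ y) × (z ≤ y → UpperBound P y)

  HasMaximum : (A → Set) → Set
  HasMaximum P = Σ A λ m → P m × UpperBound P m

  Below : (A → Set) → (A → Set) → Set
  Below P Q = ∀ x y → P x × Q y → x < y

  Between : (A → Set) → (A → Set) → A → Set
  Between P Q z = ∀ x y → P x × Q y → (x ≤ z) × (z ≤ y)

  module _ {P : A → Set} where

    sup-upperBound : ∀ {z} → IsSupremum P z → UpperBound P z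
    sup-upperBound {z} sup = proj₂ (sup z) (inj₂ refl)

    sup-least : ∀ {z y} → IsSupremum P z → UpperBound P y → z ≤ y
    sup-least {y = y} sup = proj₁ (sup y)

    least-upperBound⇒sup : ∀ {z} → UpperBound P z →
                           (∀ y → UpperBound P y → z ≤ y) → IsSupremum P z
    least-upperBound⇒sup ub-z least y =
      least y , λ z≤y x Px → ≤-trans (ub-z x Px) z≤y

    max⇒sup : ∀ {m} → P m → UpperBound P m → IsSupremum P m
    max⇒sup Pm ub-m = least-upperBound⇒sup ub-m (λ y ub-y → ub-y _ Pm)

    below⇒upperBound : ∀ {Q y} → Below P Q → Q y → UpperBound P y
    below⇒upperBound below Qy x Px = inj₁ (below x _ (Px , Qy))

    sup-between : ∀ {Q z} → IsSupremum P z → Below P Q → Between P Q z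
    sup-between sup below x y (Px , Qy) =
      sup-upperBound sup x Px , sup-least sup (below⇒upperBound below Qy)

    between⇒sup : ∀ {x₀ y₀ z} → P x₀ → UpperBound P y₀ →
                  Between P (UpperBound P) z → IsSupremum P z
    between⇒sup {x₀} {y₀} Px₀ ub-y₀ between = least-upperBound⇒sup
      (λ x Px → proj₁ (between x y₀ (Px , ub-y₀)))
      (λ y ub-y → proj₂ (between x₀ y (Px₀ , ub-y)))

    noMax⇒below : ¬ HasMaximum P → Below P (UpperBound P)
    noMax⇒below noMax x y (Px , ub-y) with ub-y x Px
    ... | inj₁ x<y  = x<y
    ... | inj₂ refl = ⊥-elim (noMax (x , Px , ub-y))

lift : ∀ {n m} → (Fin n → Fin m) → Fin (suc n) → Fin (suc m)
lift r zero    = zero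
lift r (suc i) = suc (r i)

rename : ∀ {n m} → (Fin n → Fin m) → Formula n → Formula m
rename r (i <' j) = r i <' r j
rename r (i ≐ j)  = r i ≐ r j
rename r ⊥'       = ⊥'
rename r ⊤'       = ⊤'
rename r (¬' φ)   = ¬' rename r φ
rename r (φ ∧' ψ) = rename r φ ∧' rename r ψ
rename r (φ ∨' ψ) = rename r φ ∨' rename r ψ
rename r (φ ⇒' ψ) = rename r φ ⇒' rename r ψ
rename r (∀' φ)   = ∀' rename (lift r) φ
rename r (∃' φ)   = ∃' rename (lift r) φ

_≤'_ : ∀ {n} → Fin n → Fin n → Formula n
i ≤' j = (i <' j) ∨' (i ≐ j)

-- upperBounds φ defines (in the variable zero) the upper bounds of the set
-- defined by φ; the bound variable x' of φ is kept, its parameters shifted.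
upperBounds : ∀ {n} → Formula (suc n) → Formula (suc n)
upperBounds φ = ∀' (rename (lift suc) φ ⇒' (zero ≤' suc zero))

module Semantics (O : LinearOrder) where
  open LinearOrder O

  lift-agrees : ∀ {n m} (r : Fin n → Fin m) {ρ : Fin m → D} {σ : Fin n → D} →
                (∀ i → ρ (r i) ≡ σ i) → ∀ d i → (d ∷ₑ ρ) (lift r i) ≡ (d ∷ₑ σ) i
  lift-agrees r eq d zero    = refl
  lift-agrees r eq d (suc i) = eq i

  Sat-rename : ∀ {n m} (r : Fin n → Fin m) (φ : Formula n) {ρ : Fin m → D}
               {σ : Fin n → D} → (∀ i → ρ (r i) ≡ σ i) →
               Sat O (rename r φ) ρ ⇔ Sat O φ σ
  Sat-rename r (i <' j) eq rewrite eq i | eq j = ⇔-id _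
  Sat-rename r (i ≐ j)  eq rewrite eq i | eq j = ⇔-id _
  Sat-rename r ⊥'       eq = ⇔-id _
  Sat-rename r ⊤'       eq = ⇔-id _
  Sat-rename r (¬' φ)   eq = ¬-cong-⇔ (Sat-rename r φ eq)
  Sat-rename r (φ ∧' ψ) eq = Sat-rename r φ eq ×-⇔ Sat-rename r ψ eq
  Sat-rename r (φ ∨' ψ) eq = Sat-rename r φ eq ⊎-⇔ Sat-rename r ψ eq
  Sat-rename r (φ ⇒' ψ) eq = →-cong-⇔ (Sat-rename r φ eq) (Sat-rename r ψ eq)
  Sat-rename r (∀' φ) {ρ} {σ} eq = mk⇔ (λ s d → to (under d) (s d))
                                        (λ s d → from (under d) (s d))
    where
    under : ∀ d → Sat O (rename (lift r) φ) (d ∷ₑ ρ) ⇔ Sat O φ (d ∷ₑ σ)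
    under d = Sat-rename (lift r) φ (lift-agrees r eq d)
  Sat-rename r (∃' φ) {ρ} {σ} eq = mk⇔ (λ (d , s) → d , to (under d) s)
                                        (λ (d , s) → d , from (under d) s)
    where
    under : ∀ d → Sat O (rename (lift r) φ) (d ∷ₑ ρ) ⇔ Sat O φ (d ∷ₑ σ)
    under d = Sat-rename (lift r) φ (lift-agrees r eq d)

  Sat-upperBounds : ∀ {n} (φ : Formula (suc n)) (ρ : Fin n → D) (y : D) →
                    Sat O (upperBounds φ) (y ∷ₑ ρ) ⇔ UB O φ ρ y
  Sat-upperBounds φ ρ y = mk⇔ (λ s x φx → s x (from (shift x) φx))
                              (λ ub x φx → ub x (to (shift x) φx))
    where
    shift : ∀ x → Sat O (rename (lift suc) φ) (x ∷ₑ (y ∷ₑ ρ)) ⇔ Sat O φ (x ∷ₑ ρ)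
    shift x = Sat-rename (lift suc) φ (lift-agrees suc (λ _ → refl) x)

module SupCut (O : LinearOrder) where
  open LinearOrder O
  open IsStrictTotalOrder isSTO using (trans)
  open Bounds _<_ trans
  open Semantics O

  sup⇒cut : D-Sup O → D-Cut O
  sup⇒cut sup n φ ψ ρ ((x₀ , y₀ , φx₀ , ψy₀) , below) =
    map₂ (λ isSup → sup-between isSup below)
         (sup n φ ρ ((x₀ , φx₀) , (y₀ , below⇒upperBound below ψy₀)))

  cut⇒sup : ExcludedMiddle 0ℓ → D-Cut O → D-Sup O
  cut⇒sup em cut n φ ρ ((x₀ , φx₀) , (y₀ , ub-y₀))
    with em {HasMaximum (λ x → Sat O φ (x ∷ₑ ρ))}
  ... | yes (m , φm , ub-m) = m , max⇒sup φm ub-m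
  ... | no noMax =
    map₂ (λ between → between⇒sup φx₀ ub-y₀
                        (λ x y (φx , ub-y) → between x y (φx , defineUB ub-y)))
         (cut n φ (upperBounds φ) ρ ((x₀ , y₀ , φx₀ , defineUB ub-y₀) , below))
    where
    defineUB : ∀ {y} → UB O φ ρ y → Sat O (upperBounds φ) (y ∷ₑ ρ)
    defineUB {y} = from (Sat-upperBounds φ ρ y)

    below : Below (λ x → Sat O φ (x ∷ₑ ρ)) (λ y → Sat O (upperBounds φ) (y ∷ₑ ρ))
    below x y (φx , s) = noMax⇒below noMax x y (φx , to (Sat-upperBounds φ ρ y) s)

theorem3p5 : ExcludedMiddle 0ℓ → (O : LinearOrder) →
    (D-Sup O → D-Cut O) × (D-Cut O → D-Sup O)
theorem3p5 em O = sup⇒cut , cut⇒sup em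
  where open SupCut O
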